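{- Let $\mathcal{K}$ be a non-singular conic in $\mathsf{PG}(2,8)$ and $\mathcal{P}$ an external pentagon of type $A_4$ with respect to $\mathcal{K}$. Then the projective coordinate frame can be chosen so that $\mathcal{K}$ has equation $X^2+YZ=0$ and $\mathcal{P}$ is the set of points $(1,1,0)$, $(0,1,1)$, $(\gamma,\gamma^6,1)$, $(\gamma^2,\gamma^5,1)$, $(\gamma^4,\gamma^3,1)$.
   Context: $\gamma\in\mathbb{F}_8$ is a fixed root of $X^3+X+1$. A line is external to $\mathcal{K}$ if it misses $\mathcal{K}$. Five points in general position (no three collinear) form an external pentagon with respect to $\mathcal{K}$ if all ten lines joining two of them are external to $\mathcal{K}$; it is of type $A_4$ if some group of collineations isomorphic to $A_4$ preserves both $\mathcal{K}$ and the five-point set. -}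

module Defs where

open import Data.Bool using (Bool; true; false; _xor_; _∧_; if_then_else_; not; T)
open import Data.Nat using (ℕ; zero; suc; _<ᵇ_; _%_)
open import Data.Fin using (Fin; toℕ)
open import Data.List using (List; []; _∷_; map; allFin; concatMap)
open import Data.Nat.ListAction using (sum)
open import Data.Product using (Σ; ∃; _×_; _,_; proj₁)
open import Relation.Binary.PropositionalEquality using (_≡_)
open import Relation.Nullary using (¬_)
open import Function using (_∘_; _⇔_)

-- The field F₈ = F₂[γ]/(γ³ + γ + 1); element (b₀ , b₁ , b₂) = b₀ + b₁γ + b₂γ².

record F8 : Set where
  constructor f8
  field
    c0 c1 c2 : Bool

infixl 6 _+F_
infixl 7 _*F_

_+F_ : F8 → F8 → F8
f8 a0 a1 a2 +F f8 b0 b1 b2 = f8 (a0 xor b0) (a1 xor b1) (a2 xor b2)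

-- uses γ³ = γ + 1 and γ⁴ = γ² + γ
_*F_ : F8 → F8 → F8
f8 a0 a1 a2 *F f8 b0 b1 b2 =
  f8 ((a0 ∧ b0) xor (a1 ∧ b2) xor (a2 ∧ b1))
     ((a0 ∧ b1) xor (a1 ∧ b0) xor (a1 ∧ b2) xor (a2 ∧ b1) xor (a2 ∧ b2))
     ((a0 ∧ b2) xor (a1 ∧ b1) xor (a2 ∧ b0) xor (a2 ∧ b2))

0F 1F γ : F8
0F = f8 false false false
1F = f8 true false false
γ  = f8 false true false

_^F_ : F8 → ℕ → F8
x ^F zero  = 1F
x ^F suc n = x *F (x ^F n)

isZero : F8 → Bool
isZero (f8 a b c) = not a ∧ not b ∧ not c

isOne : F8 → Bool
isOne (f8 a b c) = a ∧ not b ∧ not c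

Vec3 : Set
Vec3 = F8 × F8 × F8

-- canonical representative: the last non-zero coordinate equals 1
-- (this also excludes the zero vector)
normalized : Vec3 → Bool
normalized (x , y , z) =
  if isZero z then (if isZero y then isOne x else isOne y) else isOne z

Point : Set
Point = Σ Vec3 (λ v → T (normalized v))

coords : Point → Vec3
coords = proj₁

-- determinant of the matrix with rows u v w (characteristic 2: no signs)
det3 : Vec3 → Vec3 → Vec3 → F8
det3 (a1 , a2 , a3) (b1 , b2 , b3) (c1 , c2 , c3) =
  a1 *F b2 *F c3 +F a2 *F b3 *F c1 +F a3 *F b1 *F c2 +F
  a3 *F b2 *F c1 +F a1 *F b3 *F c2 +F a2 *F b1 *F c3

Collinear : Point → Point → Point → Set
Collinear p q r = det3 (coords p) (coords q) (coords r) ≡ 0F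

record QForm : Set where
  constructor qform
  field
    a b c d e f : F8

evalQ : QForm → Vec3 → F8
evalQ (qform a b c d e f) (x , y , z) =
  a *F x *F x +F b *F y *F y +F c *F z *F z +F
  d *F x *F y +F e *F x *F z +F f *F y *F z

_+V_ : Vec3 → Vec3 → Vec3
(x , y , z) +V (x' , y' , z') = (x +F x' , y +F y' , z +F z')

polar : QForm → Vec3 → Vec3 → F8
polar Q u v = evalQ Q (u +V v) +F evalQ Q u +F evalQ Q v

OnConic : QForm → Point → Set
OnConic Q p = evalQ Q (coords p) ≡ 0F

SingularPoint : QForm → Point → Set
SingularPoint Q p = OnConic Q p × (∀ (w : Vec3) → polar Q (coords p) w ≡ 0F)

NonSingular : QForm → Set
NonSingular Q = ∀ (p : Point) → ¬ SingularPoint Q p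

Pentagon : Set
Pentagon = Fin 5 → Point

GeneralPosition : Pentagon → Set
GeneralPosition P = ∀ (i j k : Fin 5) → ¬ i ≡ j → ¬ i ≡ k → ¬ j ≡ k →
  ¬ Collinear (P i) (P j) (P k)

ExternalPentagon : QForm → Pentagon → Set
ExternalPentagon Q P = GeneralPosition P ×
  (∀ (i j : Fin 5) → ¬ i ≡ j → ∀ (x : Point) → OnConic Q x →
     ¬ Collinear (P i) (P j) x)

Collineation : (Point → Point) → Set
Collineation f =
  (∀ p q → f p ≡ f q → p ≡ q) ×
  (∀ q → ∃ λ p → f p ≡ q) ×
  (∀ p q r → Collinear p q r ⇔ Collinear (f p) (f q) (f r))

inversions : (Fin 4 → Fin 4) → ℕ
inversions σ =
  sum (concatMap (λ i → map (λ j →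
         if (toℕ i <ᵇ toℕ j) ∧ (toℕ (σ j) <ᵇ toℕ (σ i)) then 1 else 0)
       (allFin 4)) (allFin 4))

InA4 : (Fin 4 → Fin 4) → Set
InA4 σ = (∀ i j → σ i ≡ σ j → i ≡ j) × (inversions σ % 2 ≡ 0)

Preserves : QForm → Pentagon → (Point → Point) → Set
Preserves Q P f =
  Collineation f ×
  (∀ p → OnConic Q p ⇔ OnConic Q (f p)) ×
  (∀ i → ∃ λ j → f (P i) ≡ P j)

-- A group of collineations isomorphic to A₄ preserving Q and P:
-- the image of an injective homomorphism φ from A₄ into the group of
-- collineations (under composition) preserving Q and P.
TypeA4 : QForm → Pentagon → Set
TypeA4 Q P = ∃ λ (φ : (Fin 4 → Fin 4) → Point → Point) →
  (∀ σ → InA4 σ → Preserves Q P (φ σ)) ×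
  (∀ σ τ → InA4 σ → InA4 τ → (∀ i → σ i ≡ τ i) → ∀ p → φ σ p ≡ φ τ p) ×
  (∀ σ τ → InA4 σ → InA4 τ → ∀ p → φ (σ ∘ τ) p ≡ φ σ (φ τ p)) ×
  (∀ σ τ → InA4 σ → InA4 τ → (∀ p → φ σ p ≡ φ τ p) → ∀ i → σ i ≡ τ i)

-- Change of projective coordinate frame: invertible 3×3 matrix M,
-- new coordinates of the point with old coordinates v are M v.

Mat3 : Set
Mat3 = Vec3 × Vec3 × Vec3

dot : Vec3 → Vec3 → F8
dot (x , y , z) (x' , y' , z') = x *F x' +F y *F y' +F z *F z'

_·_ : Mat3 → Vec3 → Vec3
(r1 , r2 , r3) · v = (dot r1 v , dot r2 v , dot r3 v)

detM : Mat3 → F8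
detM (r1 , r2 , r3) = det3 r1 r2 r3

Proportional : Vec3 → Vec3 → Set
Proportional (x , y , z) w = ∃ λ (l : F8) → ¬ l ≡ 0F × w ≡ (l *F x , l *F y , l *F z)

stdConic : QForm
stdConic = qform 1F 0F 0F 0F 0F 1F

stdPentagon : Fin 5 → Vec3
stdPentagon Fin.zero = (1F , 1F , 0F)
stdPentagon (Fin.suc Fin.zero) = (0F , 1F , 1F)
stdPentagon (Fin.suc (Fin.suc Fin.zero)) = (γ , γ ^F 6 , 1F)
stdPentagon (Fin.suc (Fin.suc (Fin.suc Fin.zero))) = (γ ^F 2 , γ ^F 5 , 1F)
stdPentagon (Fin.suc (Fin.suc (Fin.suc (Fin.suc Fin.zero)))) = (γ ^F 4 , γ ^F 3 , 1F)

module Submission where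

-- Four of the five points are in general position, so a projectivity A sends the standard
-- frame e₁, e₂, e₃, e₄ = (1,1,1) to them; the fifth point becomes some u.  Pulling the conic back
-- along A and scaling it to leading coefficient 1 leaves a conic X² + bY² + cZ² + dXY + eXZ + fYZ.
-- Over the 8⁵ such conics and the 73 points u, a finite computation shows: either the conic is
-- singular, or a line joining two of e₁, e₂, e₃, e₄, u meets it, or three of these points are
-- collinear, or a projectivity N sending the frame to four of the standard points maps the five
-- points onto the standard pentagon and the conic onto X² + YZ.  In the last case N A⁻¹ is the
-- required change of frame.

open import Defs
open import Relation.Binary.PropositionalEquality
open import Algebra.Bundles using (CommutativeSemiring)
open import Algebra.Core using (Op₂)
open import Algebra.Definitions {A = F8} _≡_ using (Associative; LeftIdentity; Commutative)
open import Algebra.Structures {A = F8} _≡_ using (IsCommutativeMonoid)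
open import Algebra.Structures.Biased using (IsCommutativeMonoidˡ; IsCommutativeSemiringˡ)
open import Data.Bool using (true; false; T; if_then_else_)
open import Data.Bool.ListAction using (all; any)
open import Data.Bool.Properties using () renaming (_≟_ to _≟B_)
open import Data.Fin using (Fin; zero; suc; _<_; inject₁; fromℕ)
open import Data.Fin.Properties using (_<?_; <⇒≢; inject₁-injective; fromℕ≢inject₁)
open import Data.List using (List; []; _∷_; allFin)
open import Data.List.Membership.Propositional using (_∈_)
open import Data.List.Membership.Propositional.Properties using (∈-allFin)
open import Data.List.Relation.Unary.Any using (here; there)
import Data.List.Relation.Unary.Any as Any
import Data.List.Relation.Unary.All as All
open import Data.List.Relation.Unary.All.Properties using (all⁺; all⁻)
open import Data.List.Relation.Unary.Any.Properties using (any⁺; any⁻)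
open import Data.Nat using (ℕ)
open import Data.Product using (∃; ∃₂; _×_; _,_; proj₁; proj₂)
open import Data.Sum using (_⊎_; inj₁; inj₂)
open import Function using (_∘_; _⇔_; mk⇔; Equivalence)
open import Relation.Binary.Definitions using (DecidableEquality)
open import Relation.Binary.PropositionalEquality.Algebra using (isMagma)
open import Relation.Nullary using (¬_; Dec; ¬?)
open import Relation.Nullary.Decidable
  using (from-yes; map′; _×-dec_; _⊎-dec_; _→-dec_; isYes; toWitness; fromWitness; T?; dec⇒maybe)
open import Relation.Nullary.Negation using (contradiction)
open import Tactic.RingSolver.Core.AlmostCommutativeRing using (AlmostCommutativeRing; fromCommutativeSemiring)
open import Tactic.RingSolver.Core.Expression using (Expr)

infix 4 _≟F_

_≟F_ : DecidableEquality F8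
f8 a b c ≟F f8 a′ b′ c′ =
  map′ (λ { (refl , refl , refl) → refl }) (λ { refl → refl , refl , refl })
       (a ≟B a′ ×-dec b ≟B b′ ×-dec c ≟B c′)

-- The verdict is a Boolean fold over the elements, so evaluating a large decision does not keep
-- the evidence for all its instances in memory (as nesting _×-dec_ would).
module Exhaustive {A : Set} (elements : List A) (complete : ∀ x → x ∈ elements) where

  ∀? : {P : A → Set} → ((x : A) → Dec (P x)) → Dec ((x : A) → P x)
  ∀? P? = map′ (λ t x → toWitness {a? = P? x} (All.lookup (all⁺ _ elements t) (complete x)))
               (λ h → all⁻ _ {xs = elements} (All.tabulate λ {x} _ → fromWitness {a? = P? x} (h x)))
               (T? (all (λ x → isYes (P? x)) elements))

  ∃? : {P : A → Set} → ((x : A) → Dec (P x)) → Dec (∃ P)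
  ∃? P? = map′ (λ t → let x , px = Any.satisfied (any⁻ _ elements t) in x , toWitness {a? = P? x} px)
               (λ (x , px) → any⁺ _ (Any.map (λ { refl → fromWitness {a? = P? x} px }) (complete x)))
               (T? (any (λ x → isYes (P? x)) elements))

∈-Bools : ∀ b → b ∈ false ∷ true ∷ []
∈-Bools false = here refl
∈-Bools true = there (here refl)

module ExhaustiveBool = Exhaustive (false ∷ true ∷ []) ∈-Bools

∀F8? : {P : F8 → Set} → ((x : F8) → Dec (P x)) → Dec ((x : F8) → P x)
∀F8? P? = map′ (λ h x → h (F8.c0 x) (F8.c1 x) (F8.c2 x)) (λ h a b c → h (f8 a b c))
               (∀? λ a → ∀? λ b → ∀? λ c → P? (f8 a b c))
  where open ExhaustiveBool

∃F8? : {P : F8 → Set} → ((x : F8) → Dec (P x)) → Dec (∃ P)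
∃F8? P? = map′ (λ { (a , b , c , p) → f8 a b c , p }) (λ { (x , p) → F8.c0 x , F8.c1 x , F8.c2 x , p })
               (∃? λ a → ∃? λ b → ∃? λ c → P? (f8 a b c))
  where open ExhaustiveBool

∀Vec3? : {P : Vec3 → Set} → ((v : Vec3) → Dec (P v)) → Dec ((v : Vec3) → P v)
∀Vec3? P? = map′ (λ h (x , y , z) → h x y z) (λ h x y z → h (x , y , z))
                 (∀F8? λ x → ∀F8? λ y → ∀F8? λ z → P? (x , y , z))

∀Fin? : ∀ {n} {P : Fin n → Set} → ((i : Fin n) → Dec (P i)) → Dec ((i : Fin n) → P i)
∀Fin? = Exhaustive.∀? (allFin _) ∈-allFin

∃Fin? : ∀ {n} {P : Fin n → Set} → ((i : Fin n) → Dec (P i)) → Dec (∃ P)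
∃Fin? = Exhaustive.∃? (allFin _) ∈-allFin

+F-identityˡ : ∀ x → 0F +F x ≡ x
+F-identityˡ _ = refl

+F-comm : ∀ x y → x +F y ≡ y +F x
+F-comm = from-yes (∀F8? λ x → ∀F8? λ y → x +F y ≟F y +F x)

+F-assoc : ∀ x y z → (x +F y) +F z ≡ x +F (y +F z)
+F-assoc = from-yes (∀F8? λ x → ∀F8? λ y → ∀F8? λ z → (x +F y) +F z ≟F x +F (y +F z))

*F-identityˡ : ∀ x → 1F *F x ≡ x
*F-identityˡ = from-yes (∀F8? λ x → 1F *F x ≟F x)

*F-identityʳ : ∀ x → x *F 1F ≡ x
*F-identityʳ = from-yes (∀F8? λ x → x *F 1F ≟F x)

*F-zeroˡ : ∀ x → 0F *F x ≡ 0F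
*F-zeroˡ = from-yes (∀F8? λ x → 0F *F x ≟F 0F)

*F-zeroʳ : ∀ x → x *F 0F ≡ 0F
*F-zeroʳ = from-yes (∀F8? λ x → x *F 0F ≟F 0F)

*F-comm : ∀ x y → x *F y ≡ y *F x
*F-comm = from-yes (∀F8? λ x → ∀F8? λ y → x *F y ≟F y *F x)

*F-assoc : ∀ x y z → (x *F y) *F z ≡ x *F (y *F z)
*F-assoc = from-yes (∀F8? λ x → ∀F8? λ y → ∀F8? λ z → (x *F y) *F z ≟F x *F (y *F z))

*F-distribˡ : ∀ x y z → x *F (y +F z) ≡ x *F y +F x *F z
*F-distribˡ = from-yes (∀F8? λ x → ∀F8? λ y → ∀F8? λ z → x *F (y +F z) ≟F x *F y +F x *F z)

*F-distribʳ : ∀ x y z → (y +F z) *F x ≡ y *F x +F z *F x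
*F-distribʳ = from-yes (∀F8? λ x → ∀F8? λ y → ∀F8? λ z → (y +F z) *F x ≟F y *F x +F z *F x)

*F-≢0 : ∀ x y → x ≢ 0F → y ≢ 0F → x *F y ≢ 0F
*F-≢0 = from-yes (∀F8? λ x → ∀F8? λ y → ¬? (x ≟F 0F) →-dec ¬? (y ≟F 0F) →-dec ¬? (x *F y ≟F 0F))

*F-cancelˡ-≡0 : ∀ x y → x ≢ 0F → x *F y ≡ 0F → y ≡ 0F
*F-cancelˡ-≡0 = from-yes (∀F8? λ x → ∀F8? λ y → ¬? (x ≟F 0F) →-dec x *F y ≟F 0F →-dec y ≟F 0F)

infix 30 _⁻¹

-- x⁶ is the inverse of x ≢ 0 since F₈ˣ has order 7 (and 0 ⁻¹ = 0).
_⁻¹ : F8 → F8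
x ⁻¹ = x ^F 6

⁻¹-≢0 : ∀ x → x ≢ 0F → x ⁻¹ ≢ 0F
⁻¹-≢0 = from-yes (∀F8? λ x → ¬? (x ≟F 0F) →-dec ¬? (x ⁻¹ ≟F 0F))

⁻¹-inverseˡ : ∀ x → x ≢ 0F → x ⁻¹ *F x ≡ 1F
⁻¹-inverseˡ = from-yes (∀F8? λ x → ¬? (x ≟F 0F) →-dec x ⁻¹ *F x ≟F 1F)

⁻¹-cancelˡ : ∀ x y → x ≢ 0F → x ⁻¹ *F (x *F y) ≡ y
⁻¹-cancelˡ = from-yes (∀F8? λ x → ∀F8? λ y → ¬? (x ≟F 0F) →-dec x ⁻¹ *F (x *F y) ≟F y)

⁻¹-cancelʳ : ∀ x y → x ≢ 0F → x *F (x ⁻¹ *F y) ≡ y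
⁻¹-cancelʳ = from-yes (∀F8? λ x → ∀F8? λ y → ¬? (x ≟F 0F) →-dec x *F (x ⁻¹ *F y) ≟F y)

F8-commutativeSemiring : CommutativeSemiring _ _
F8-commutativeSemiring = record
  { isCommutativeSemiring = IsCommutativeSemiringˡ.isCommutativeSemiring record
    { +-isCommutativeMonoid = commutativeMonoid _+F_ 0F +F-assoc +F-identityˡ +F-comm
    ; *-isCommutativeMonoid = commutativeMonoid _*F_ 1F *F-assoc *F-identityˡ *F-comm
    ; distribʳ = *F-distribʳ
    ; zeroˡ = *F-zeroˡ
    }
  }
  where
  commutativeMonoid : (_∙_ : Op₂ F8) (ε : F8) → Associative _∙_ → LeftIdentity ε _∙_ → Commutative _∙_ →
                      IsCommutativeMonoid _∙_ ε
  commutativeMonoid _∙_ ε assoc identityˡ comm = IsCommutativeMonoidˡ.isCommutativeMonoid record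
    { isSemigroup = record { isMagma = isMagma _∙_ ; assoc = assoc } ; identityˡ = identityˡ ; comm = comm }

F8-ring : AlmostCommutativeRing _ _
F8-ring = fromCommutativeSemiring F8-commutativeSemiring (λ x → dec⇒maybe (0F ≟F x))

open import Tactic.RingSolver.NonReflective F8-ring using (solve; _⊜_; _⊕_; _⊗_; Κ)

infixr 25 _•_
infixl 7 _⊙_
infix 4 _≟V_ _≟Q_

_•_ : F8 → Vec3 → Vec3
k • (x , y , z) = (k *F x , k *F y , k *F z)

0V e₁ e₂ e₃ e₄ : Vec3
0V = (0F , 0F , 0F)
e₁ = (1F , 0F , 0F)
e₂ = (0F , 1F , 0F)
e₃ = (0F , 0F , 1F)
e₄ = (1F , 1F , 1F)

cross : Vec3 → Vec3 → Vec3
cross (u₁ , u₂ , u₃) (v₁ , v₂ , v₃) = (u₂ *F v₃ +F u₃ *F v₂ , u₃ *F v₁ +F u₁ *F v₃ , u₁ *F v₂ +F u₂ *F v₁)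

tr : Mat3 → Mat3
tr ((a₁ , a₂ , a₃) , (b₁ , b₂ , b₃) , (c₁ , c₂ , c₃)) = ((a₁ , b₁ , c₁) , (a₂ , b₂ , c₂) , (a₃ , b₃ , c₃))

cof : Mat3 → Mat3
cof (r , s , t) = (cross s t , cross t r , cross r s)

adj : Mat3 → Mat3
adj M = tr (cof M)

_⊙_ : Mat3 → Mat3 → Mat3
(n₁ , n₂ , n₃) ⊙ B = (tr B · n₁ , tr B · n₂ , tr B · n₃)

compose : QForm → Mat3 → QForm
compose Q M with tr M
... | (c₁ , c₂ , c₃) = qform (evalQ Q c₁) (evalQ Q c₂) (evalQ Q c₃) (polar Q c₁ c₂) (polar Q c₁ c₃) (polar Q c₂ c₃)

scaleQ : F8 → QForm → QForm
scaleQ k (qform a b c d e f) = qform (k *F a) (k *F b) (k *F c) (k *F d) (k *F e) (k *F f)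

nucleus : QForm → Vec3
nucleus (qform a b c d e f) = (f , e , d)

_≟V_ : (v w : Vec3) → Dec (v ≡ w)
(x , y , z) ≟V (x′ , y′ , z′) =
  map′ (λ { (refl , refl , refl) → refl }) (λ { refl → refl , refl , refl })
       (x ≟F x′ ×-dec y ≟F y′ ×-dec z ≟F z′)

_≟Q_ : (Q Q′ : QForm) → Dec (Q ≡ Q′)
qform a b c d e f ≟Q qform a′ b′ c′ d′ e′ f′ =
  map′ (λ { (refl , refl , refl , refl , refl , refl) → refl }) (λ { refl → refl , refl , refl , refl , refl , refl })
       (a ≟F a′ ×-dec b ≟F b′ ×-dec c ≟F c′ ×-dec d ≟F d′ ×-dec e ≟F e′ ×-dec f ≟F f′)

coords≡ : ∀ {x y z x′ y′ z′ : F8} → x ≡ x′ → y ≡ y′ → z ≡ z′ → (x , y , z) ≡ (x′ , y′ , z′)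
coords≡ refl refl refl = refl

dot-e₁ : ∀ v → dot v e₁ ≡ proj₁ v
dot-e₁ = from-yes (∀Vec3? λ v → dot v e₁ ≟F proj₁ v)

dot-e₂ : ∀ v → dot v e₂ ≡ proj₁ (proj₂ v)
dot-e₂ = from-yes (∀Vec3? λ v → dot v e₂ ≟F proj₁ (proj₂ v))

dot-e₃ : ∀ v → dot v e₃ ≡ proj₂ (proj₂ v)
dot-e₃ = from-yes (∀Vec3? λ v → dot v e₃ ≟F proj₂ (proj₂ v))

dot-e₄ : ∀ v → dot v e₄ ≡ proj₁ v +F proj₁ (proj₂ v) +F proj₂ (proj₂ v)
dot-e₄ = from-yes (∀Vec3? λ v → dot v e₄ ≟F proj₁ v +F proj₁ (proj₂ v) +F proj₂ (proj₂ v))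

-- A vector identity is proved as one scalar identity, paired with a generic vector l.
≡-by-dot : ∀ {v w} → (∀ l → dot v l ≡ dot w l) → v ≡ w
≡-by-dot {v} {w} h = coords≡ (coordinate e₁ dot-e₁) (coordinate e₂ dot-e₂) (coordinate e₃ dot-e₃)
  where
  coordinate : ∀ e {π : Vec3 → F8} → (∀ u → dot u e ≡ π u) → π v ≡ π w
  coordinate e dot-e = trans (sym (dot-e v)) (trans (h e) (dot-e w))

-- The coordinate formulas above and in Defs, transcribed into the ring solver's syntax; their
-- semantics are definitionally the formulas themselves, so identities can be stated with them.
module Formulas {n : ℕ} where
  E : Set
  E = Expr F8 n

  Vᴱ : Set
  Vᴱ = E × E × E

  Mᴱ : Set
  Mᴱ = Vᴱ × Vᴱ × Vᴱ

  infixr 25 _•ᴱ_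

  _+ᴱ_ : Vᴱ → Vᴱ → Vᴱ
  (x , y , z) +ᴱ (x′ , y′ , z′) = (x ⊕ x′ , y ⊕ y′ , z ⊕ z′)

  _•ᴱ_ : E → Vᴱ → Vᴱ
  k •ᴱ (x , y , z) = (k ⊗ x , k ⊗ y , k ⊗ z)

  dotᴱ : Vᴱ → Vᴱ → E
  dotᴱ (x , y , z) (x′ , y′ , z′) = x ⊗ x′ ⊕ y ⊗ y′ ⊕ z ⊗ z′

  _·ᴱ_ : Mᴱ → Vᴱ → Vᴱ
  (r₁ , r₂ , r₃) ·ᴱ v = (dotᴱ r₁ v , dotᴱ r₂ v , dotᴱ r₃ v)

  det3ᴱ : Vᴱ → Vᴱ → Vᴱ → E
  det3ᴱ (a1 , a2 , a3) (b1 , b2 , b3) (c1 , c2 , c3) =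
    a1 ⊗ b2 ⊗ c3 ⊕ a2 ⊗ b3 ⊗ c1 ⊕ a3 ⊗ b1 ⊗ c2 ⊕
    a3 ⊗ b2 ⊗ c1 ⊕ a1 ⊗ b3 ⊗ c2 ⊕ a2 ⊗ b1 ⊗ c3

  detMᴱ : Mᴱ → E
  detMᴱ (r , s , t) = det3ᴱ r s t

  crossᴱ : Vᴱ → Vᴱ → Vᴱ
  crossᴱ (u₁ , u₂ , u₃) (v₁ , v₂ , v₃) = (u₂ ⊗ v₃ ⊕ u₃ ⊗ v₂ , u₃ ⊗ v₁ ⊕ u₁ ⊗ v₃ , u₁ ⊗ v₂ ⊕ u₂ ⊗ v₁)

  trᴱ : Mᴱ → Mᴱ
  trᴱ ((a₁ , a₂ , a₃) , (b₁ , b₂ , b₃) , (c₁ , c₂ , c₃)) = ((a₁ , b₁ , c₁) , (a₂ , b₂ , c₂) , (a₃ , b₃ , c₃))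

  cofᴱ : Mᴱ → Mᴱ
  cofᴱ (r , s , t) = (crossᴱ s t , crossᴱ t r , crossᴱ r s)

  adjᴱ : Mᴱ → Mᴱ
  adjᴱ M = trᴱ (cofᴱ M)

  evalQᴱ : E → E → E → E → E → E → Vᴱ → E
  evalQᴱ a b c d e f (x , y , z) =
    a ⊗ x ⊗ x ⊕ b ⊗ y ⊗ y ⊕ c ⊗ z ⊗ z ⊕ d ⊗ x ⊗ y ⊕ e ⊗ x ⊗ z ⊕ f ⊗ y ⊗ z

  polarᴱ : E → E → E → E → E → E → Vᴱ → Vᴱ → E
  polarᴱ a b c d e f u v = evalQᴱ a b c d e f (u +ᴱ v) ⊕ evalQᴱ a b c d e f u ⊕ evalQᴱ a b c d e f v

open Formulas

·-+V : ∀ M u v → M · (u +V v) ≡ (M · u) +V (M · v)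
·-+V ((a₁ , a₂ , a₃) , (b₁ , b₂ , b₃) , (c₁ , c₂ , c₃)) (u₁ , u₂ , u₃) (v₁ , v₂ , v₃) = ≡-by-dot λ (l₁ , l₂ , l₃) →
  solve 18 (λ a₁ a₂ a₃ b₁ b₂ b₃ c₁ c₂ c₃ u₁ u₂ u₃ v₁ v₂ v₃ l₁ l₂ l₃ →
    let M = (a₁ , a₂ , a₃) , (b₁ , b₂ , b₃) , (c₁ , c₂ , c₃); u = (u₁ , u₂ , u₃); v = (v₁ , v₂ , v₃); l = (l₁ , l₂ , l₃) in
    dotᴱ (M ·ᴱ (u +ᴱ v)) l ⊜ dotᴱ ((M ·ᴱ u) +ᴱ (M ·ᴱ v)) l)
    refl a₁ a₂ a₃ b₁ b₂ b₃ c₁ c₂ c₃ u₁ u₂ u₃ v₁ v₂ v₃ l₁ l₂ l₃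

·-• : ∀ M k v → M · (k • v) ≡ k • (M · v)
·-• ((a₁ , a₂ , a₃) , (b₁ , b₂ , b₃) , (c₁ , c₂ , c₃)) k (v₁ , v₂ , v₃) = ≡-by-dot λ (l₁ , l₂ , l₃) →
  solve 16 (λ a₁ a₂ a₃ b₁ b₂ b₃ c₁ c₂ c₃ k v₁ v₂ v₃ l₁ l₂ l₃ →
    let M = (a₁ , a₂ , a₃) , (b₁ , b₂ , b₃) , (c₁ , c₂ , c₃); v = (v₁ , v₂ , v₃); l = (l₁ , l₂ , l₃) in
    dotᴱ (M ·ᴱ (k •ᴱ v)) l ⊜ dotᴱ (k •ᴱ (M ·ᴱ v)) l)
    refl a₁ a₂ a₃ b₁ b₂ b₃ c₁ c₂ c₃ k v₁ v₂ v₃ l₁ l₂ l₃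

dot-tr-· : ∀ B n v → dot (tr B · n) v ≡ dot n (B · v)
dot-tr-· ((a₁ , a₂ , a₃) , (b₁ , b₂ , b₃) , (c₁ , c₂ , c₃)) (n₁ , n₂ , n₃) (v₁ , v₂ , v₃) =
  solve 15 (λ a₁ a₂ a₃ b₁ b₂ b₃ c₁ c₂ c₃ n₁ n₂ n₃ v₁ v₂ v₃ →
    let B = (a₁ , a₂ , a₃) , (b₁ , b₂ , b₃) , (c₁ , c₂ , c₃); n = (n₁ , n₂ , n₃); v = (v₁ , v₂ , v₃) in
    dotᴱ (trᴱ B ·ᴱ n) v ⊜ dotᴱ n (B ·ᴱ v))
    refl a₁ a₂ a₃ b₁ b₂ b₃ c₁ c₂ c₃ n₁ n₂ n₃ v₁ v₂ v₃

det3-dot-cross : ∀ u v w → det3 u v w ≡ dot u (cross v w)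
det3-dot-cross (u₁ , u₂ , u₃) (v₁ , v₂ , v₃) (w₁ , w₂ , w₃) =
  solve 9 (λ u₁ u₂ u₃ v₁ v₂ v₃ w₁ w₂ w₃ →
    let u = (u₁ , u₂ , u₃); v = (v₁ , v₂ , v₃); w = (w₁ , w₂ , w₃) in
    det3ᴱ u v w ⊜ dotᴱ u (crossᴱ v w))
    refl u₁ u₂ u₃ v₁ v₂ v₃ w₁ w₂ w₃

cross-· : ∀ M v w → cross (M · v) (M · w) ≡ cof M · cross v w
cross-· ((a₁ , a₂ , a₃) , (b₁ , b₂ , b₃) , (c₁ , c₂ , c₃)) (v₁ , v₂ , v₃) (w₁ , w₂ , w₃) = ≡-by-dot λ (l₁ , l₂ , l₃) →
  solve 18 (λ a₁ a₂ a₃ b₁ b₂ b₃ c₁ c₂ c₃ v₁ v₂ v₃ w₁ w₂ w₃ l₁ l₂ l₃ →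
    let M = (a₁ , a₂ , a₃) , (b₁ , b₂ , b₃) , (c₁ , c₂ , c₃); v = (v₁ , v₂ , v₃); w = (w₁ , w₂ , w₃); l = (l₁ , l₂ , l₃) in
    dotᴱ (crossᴱ (M ·ᴱ v) (M ·ᴱ w)) l ⊜ dotᴱ (cofᴱ M ·ᴱ crossᴱ v w) l)
    refl a₁ a₂ a₃ b₁ b₂ b₃ c₁ c₂ c₃ v₁ v₂ v₃ w₁ w₂ w₃ l₁ l₂ l₃

dot-·-cof : ∀ M u x → dot (M · u) (cof M · x) ≡ detM M *F dot u x
dot-·-cof ((a₁ , a₂ , a₃) , (b₁ , b₂ , b₃) , (c₁ , c₂ , c₃)) (u₁ , u₂ , u₃) (x₁ , x₂ , x₃) =
  solve 15 (λ a₁ a₂ a₃ b₁ b₂ b₃ c₁ c₂ c₃ u₁ u₂ u₃ x₁ x₂ x₃ →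
    let M = (a₁ , a₂ , a₃) , (b₁ , b₂ , b₃) , (c₁ , c₂ , c₃); u = (u₁ , u₂ , u₃); x = (x₁ , x₂ , x₃) in
    dotᴱ (M ·ᴱ u) (cofᴱ M ·ᴱ x) ⊜ detMᴱ M ⊗ dotᴱ u x)
    refl a₁ a₂ a₃ b₁ b₂ b₃ c₁ c₂ c₃ u₁ u₂ u₃ x₁ x₂ x₃

detM-tr : ∀ M → detM (tr M) ≡ detM M
detM-tr ((a₁ , a₂ , a₃) , (b₁ , b₂ , b₃) , (c₁ , c₂ , c₃)) =
  solve 9 (λ a₁ a₂ a₃ b₁ b₂ b₃ c₁ c₂ c₃ →
    let M = (a₁ , a₂ , a₃) , (b₁ , b₂ , b₃) , (c₁ , c₂ , c₃) in
    detMᴱ (trᴱ M) ⊜ detMᴱ M)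
    refl a₁ a₂ a₃ b₁ b₂ b₃ c₁ c₂ c₃

detM-adj : ∀ M → detM (adj M) ≡ detM M *F detM M
detM-adj ((a₁ , a₂ , a₃) , (b₁ , b₂ , b₃) , (c₁ , c₂ , c₃)) =
  solve 9 (λ a₁ a₂ a₃ b₁ b₂ b₃ c₁ c₂ c₃ →
    let M = (a₁ , a₂ , a₃) , (b₁ , b₂ , b₃) , (c₁ , c₂ , c₃) in
    detMᴱ (adjᴱ M) ⊜ detMᴱ M ⊗ detMᴱ M)
    refl a₁ a₂ a₃ b₁ b₂ b₃ c₁ c₂ c₃

adj-·-cancel : ∀ M v → adj M · (M · v) ≡ detM M • v
adj-·-cancel ((a₁ , a₂ , a₃) , (b₁ , b₂ , b₃) , (c₁ , c₂ , c₃)) (v₁ , v₂ , v₃) = ≡-by-dot λ (l₁ , l₂ , l₃) →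
  solve 15 (λ a₁ a₂ a₃ b₁ b₂ b₃ c₁ c₂ c₃ v₁ v₂ v₃ l₁ l₂ l₃ →
    let M = (a₁ , a₂ , a₃) , (b₁ , b₂ , b₃) , (c₁ , c₂ , c₃); v = (v₁ , v₂ , v₃); l = (l₁ , l₂ , l₃) in
    dotᴱ (adjᴱ M ·ᴱ (M ·ᴱ v)) l ⊜ dotᴱ (detMᴱ M •ᴱ v) l)
    refl a₁ a₂ a₃ b₁ b₂ b₃ c₁ c₂ c₃ v₁ v₂ v₃ l₁ l₂ l₃

·-adj-cancel : ∀ M v → M · (adj M · v) ≡ detM M • v
·-adj-cancel ((a₁ , a₂ , a₃) , (b₁ , b₂ , b₃) , (c₁ , c₂ , c₃)) (v₁ , v₂ , v₃) = ≡-by-dot λ (l₁ , l₂ , l₃) →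
  solve 15 (λ a₁ a₂ a₃ b₁ b₂ b₃ c₁ c₂ c₃ v₁ v₂ v₃ l₁ l₂ l₃ →
    let M = (a₁ , a₂ , a₃) , (b₁ , b₂ , b₃) , (c₁ , c₂ , c₃); v = (v₁ , v₂ , v₃); l = (l₁ , l₂ , l₃) in
    dotᴱ (M ·ᴱ (adjᴱ M ·ᴱ v)) l ⊜ dotᴱ (detMᴱ M •ᴱ v) l)
    refl a₁ a₂ a₃ b₁ b₂ b₃ c₁ c₂ c₃ v₁ v₂ v₃ l₁ l₂ l₃

det3-• : ∀ a b c u v w → det3 (a • u) (b • v) (c • w) ≡ a *F b *F c *F det3 u v w
det3-• a b c (u₁ , u₂ , u₃) (v₁ , v₂ , v₃) (w₁ , w₂ , w₃) =
  solve 12 (λ a b c u₁ u₂ u₃ v₁ v₂ v₃ w₁ w₂ w₃ →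
    let u = (u₁ , u₂ , u₃); v = (v₁ , v₂ , v₃); w = (w₁ , w₂ , w₃) in
    det3ᴱ (a •ᴱ u) (b •ᴱ v) (c •ᴱ w) ⊜ a ⊗ b ⊗ c ⊗ det3ᴱ u v w)
    refl a b c u₁ u₂ u₃ v₁ v₂ v₃ w₁ w₂ w₃

det3-0V : ∀ v w → det3 0V v w ≡ 0F
det3-0V (v₁ , v₂ , v₃) (w₁ , w₂ , w₃) =
  solve 6 (λ v₁ v₂ v₃ w₁ w₂ w₃ → det3ᴱ (Κ 0F , Κ 0F , Κ 0F) (v₁ , v₂ , v₃) (w₁ , w₂ , w₃) ⊜ Κ 0F)
    refl v₁ v₂ v₃ w₁ w₂ w₃

det3-repeat : ∀ u v → det3 u v u ≡ 0F
det3-repeat (u₁ , u₂ , u₃) (v₁ , v₂ , v₃) =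
  solve 6 (λ u₁ u₂ u₃ v₁ v₂ v₃ → det3ᴱ (u₁ , u₂ , u₃) (v₁ , v₂ , v₃) (u₁ , u₂ , u₃) ⊜ Κ 0F)
    refl u₁ u₂ u₃ v₁ v₂ v₃

det3-line : ∀ s v w → det3 v w (s • v +V w) ≡ 0F
det3-line s (v₁ , v₂ , v₃) (w₁ , w₂ , w₃) =
  solve 7 (λ s v₁ v₂ v₃ w₁ w₂ w₃ →
    let v = (v₁ , v₂ , v₃); w = (w₁ , w₂ , w₃) in
    det3ᴱ v w (s •ᴱ v +ᴱ w) ⊜ Κ 0F)
    refl s v₁ v₂ v₃ w₁ w₂ w₃

cramer : ∀ p₀ p₁ p₂ p₃ → (det3 p₃ p₁ p₂ • p₀ +V det3 p₀ p₃ p₂ • p₁) +V det3 p₀ p₁ p₃ • p₂ ≡ det3 p₀ p₁ p₂ • p₃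
cramer (x₁ , x₂ , x₃) (y₁ , y₂ , y₃) (z₁ , z₂ , z₃) (t₁ , t₂ , t₃) = ≡-by-dot λ (l₁ , l₂ , l₃) →
  solve 15 (λ x₁ x₂ x₃ y₁ y₂ y₃ z₁ z₂ z₃ t₁ t₂ t₃ l₁ l₂ l₃ →
    let p₀ = (x₁ , x₂ , x₃); p₁ = (y₁ , y₂ , y₃); p₂ = (z₁ , z₂ , z₃); p₃ = (t₁ , t₂ , t₃); l = (l₁ , l₂ , l₃) in
    dotᴱ ((det3ᴱ p₃ p₁ p₂ •ᴱ p₀ +ᴱ det3ᴱ p₀ p₃ p₂ •ᴱ p₁) +ᴱ det3ᴱ p₀ p₁ p₃ •ᴱ p₂) l ⊜ dotᴱ (det3ᴱ p₀ p₁ p₂ •ᴱ p₃) l)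
    refl x₁ x₂ x₃ y₁ y₂ y₃ z₁ z₂ z₃ t₁ t₂ t₃ l₁ l₂ l₃

evalQ-compose : ∀ Q M v → evalQ (compose Q M) v ≡ evalQ Q (M · v)
evalQ-compose (qform a b c d e f) ((m₁ , m₂ , m₃) , (n₁ , n₂ , n₃) , (p₁ , p₂ , p₃)) (v₁ , v₂ , v₃) =
  solve 18 (λ a b c d e f m₁ m₂ m₃ n₁ n₂ n₃ p₁ p₂ p₃ v₁ v₂ v₃ →
    let Q = evalQᴱ a b c d e f; B = polarᴱ a b c d e f
        M = (m₁ , m₂ , m₃) , (n₁ , n₂ , n₃) , (p₁ , p₂ , p₃); c₁ = (m₁ , n₁ , p₁); c₂ = (m₂ , n₂ , p₂); c₃ = (m₃ , n₃ , p₃) in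
    evalQᴱ (Q c₁) (Q c₂) (Q c₃) (B c₁ c₂) (B c₁ c₃) (B c₂ c₃) (v₁ , v₂ , v₃) ⊜ Q (M ·ᴱ (v₁ , v₂ , v₃)))
    refl a b c d e f m₁ m₂ m₃ n₁ n₂ n₃ p₁ p₂ p₃ v₁ v₂ v₃

evalQ-scaleQ : ∀ k Q v → evalQ (scaleQ k Q) v ≡ k *F evalQ Q v
evalQ-scaleQ k (qform a b c d e f) (v₁ , v₂ , v₃) =
  solve 10 (λ k a b c d e f v₁ v₂ v₃ →
    evalQᴱ (k ⊗ a) (k ⊗ b) (k ⊗ c) (k ⊗ d) (k ⊗ e) (k ⊗ f) (v₁ , v₂ , v₃) ⊜ k ⊗ evalQᴱ a b c d e f (v₁ , v₂ , v₃))
    refl k a b c d e f v₁ v₂ v₃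

evalQ-• : ∀ Q k v → evalQ Q (k • v) ≡ k *F k *F evalQ Q v
evalQ-• (qform a b c d e f) k (v₁ , v₂ , v₃) =
  solve 10 (λ a b c d e f k v₁ v₂ v₃ →
    evalQᴱ a b c d e f (k •ᴱ (v₁ , v₂ , v₃)) ⊜ k ⊗ k ⊗ evalQᴱ a b c d e f (v₁ , v₂ , v₃))
    refl a b c d e f k v₁ v₂ v₃

evalQ-line : ∀ Q s v w → evalQ Q (s • v +V w) ≡ s *F s *F evalQ Q v +F s *F polar Q v w +F evalQ Q w
evalQ-line (qform a b c d e f) s (v₁ , v₂ , v₃) (w₁ , w₂ , w₃) =
  solve 13 (λ a b c d e f s v₁ v₂ v₃ w₁ w₂ w₃ →
    let Q = evalQᴱ a b c d e f; v = (v₁ , v₂ , v₃); w = (w₁ , w₂ , w₃) in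
    Q (s •ᴱ v +ᴱ w) ⊜ (s ⊗ s ⊗ Q v ⊕ s ⊗ polarᴱ a b c d e f v w ⊕ Q w))
    refl a b c d e f s v₁ v₂ v₃ w₁ w₂ w₃

polar-•ˡ : ∀ Q k u w → polar Q (k • u) w ≡ k *F polar Q u w
polar-•ˡ (qform a b c d e f) k (u₁ , u₂ , u₃) (w₁ , w₂ , w₃) =
  solve 13 (λ a b c d e f k u₁ u₂ u₃ w₁ w₂ w₃ →
    let u = (u₁ , u₂ , u₃); w = (w₁ , w₂ , w₃) in
    polarᴱ a b c d e f (k •ᴱ u) w ⊜ k ⊗ polarᴱ a b c d e f u w)
    refl a b c d e f k u₁ u₂ u₃ w₁ w₂ w₃

polar-•ʳ : ∀ Q k u w → polar Q u (k • w) ≡ k *F polar Q u w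
polar-•ʳ (qform a b c d e f) k (u₁ , u₂ , u₃) (w₁ , w₂ , w₃) =
  solve 13 (λ a b c d e f k u₁ u₂ u₃ w₁ w₂ w₃ →
    let u = (u₁ , u₂ , u₃); w = (w₁ , w₂ , w₃) in
    polarᴱ a b c d e f u (k •ᴱ w) ⊜ k ⊗ polarᴱ a b c d e f u w)
    refl a b c d e f k u₁ u₂ u₃ w₁ w₂ w₃

polar-nucleus : ∀ Q w → polar Q (nucleus Q) w ≡ 0F
polar-nucleus (qform a b c d e f) (w₁ , w₂ , w₃) =
  solve 9 (λ a b c d e f w₁ w₂ w₃ → polarᴱ a b c d e f (f , e , d) (w₁ , w₂ , w₃) ⊜ Κ 0F)
    refl a b c d e f w₁ w₂ w₃

•-identityˡ : ∀ v → 1F • v ≡ v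
•-identityˡ = from-yes (∀Vec3? λ v → 1F • v ≟V v)

•-zeroˡ : ∀ v → 0F • v ≡ 0V
•-zeroˡ = from-yes (∀Vec3? λ v → 0F • v ≟V 0V)

•-assoc : ∀ k m v → k • (m • v) ≡ (k *F m) • v
•-assoc k m (x , y , z) = sym (coords≡ (*F-assoc k m x) (*F-assoc k m y) (*F-assoc k m z))

•-cancel-0V : ∀ k v → k ≢ 0F → k • v ≡ 0V → v ≡ 0V
•-cancel-0V = from-yes (∀F8? λ k → ∀Vec3? λ v → ¬? (k ≟F 0F) →-dec k • v ≟V 0V →-dec v ≟V 0V)

·-0V : ∀ M → M · 0V ≡ 0V
·-0V M = trans (·-• M 0F 0V) (•-zeroˡ (M · 0V))

det3-· : ∀ M u v w → det3 (M · u) (M · v) (M · w) ≡ detM M *F det3 u v w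
det3-· M u v w = begin
  det3 (M · u) (M · v) (M · w)           ≡⟨ det3-dot-cross (M · u) (M · v) (M · w) ⟩
  dot (M · u) (cross (M · v) (M · w))    ≡⟨ cong (dot (M · u)) (cross-· M v w) ⟩
  dot (M · u) (cof M · cross v w)        ≡⟨ dot-·-cof M u (cross v w) ⟩
  detM M *F dot u (cross v w)            ≡⟨ cong (detM M *F_) (sym (det3-dot-cross u v w)) ⟩
  detM M *F det3 u v w                   ∎
  where open ≡-Reasoning

·-≢0V : ∀ M {x} → detM M ≢ 0F → x ≢ 0V → M · x ≢ 0V
·-≢0V M {x} detM≢0 x≢0 Mx≡0 = x≢0 (•-cancel-0V (detM M) x detM≢0 (begin
  detM M • x             ≡⟨ sym (adj-·-cancel M x) ⟩
  adj M · (M · x)        ≡⟨ cong (adj M ·_) Mx≡0 ⟩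
  adj M · 0V             ≡⟨ ·-0V (adj M) ⟩
  0V                     ∎))
  where open ≡-Reasoning

detM-adj≢0 : ∀ M → detM M ≢ 0F → detM (adj M) ≢ 0F
detM-adj≢0 M detM≢0 = subst (_≢ 0F) (sym (detM-adj M)) (*F-≢0 (detM M) (detM M) detM≢0 detM≢0)

⊙-· : ∀ N B v → (N ⊙ B) · v ≡ N · (B · v)
⊙-· (n₁ , n₂ , n₃) B v = coords≡ (dot-tr-· B n₁ v) (dot-tr-· B n₂ v) (dot-tr-· B n₃ v)

detM-⊙ : ∀ N B → detM (N ⊙ B) ≡ detM B *F detM N
detM-⊙ (n₁ , n₂ , n₃) B = trans (det3-· (tr B) n₁ n₂ n₃) (cong (_*F det3 n₁ n₂ n₃) (detM-tr B))

coords≢0V : ∀ (p : Point) → coords p ≢ 0V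
coords≢0V (v , normal) refl = normal

-- Scaling by the inverse of the last non-zero coordinate gives the representative chosen in Defs.
leading : Vec3 → F8
leading (x , y , z) = if isZero z then (if isZero y then x else y) else z

representative : Vec3 → Vec3
representative v = leading v ⁻¹ • v

leading≢0 : ∀ v → v ≢ 0V → leading v ≢ 0F
leading≢0 = from-yes (∀Vec3? λ v → ¬? (v ≟V 0V) →-dec ¬? (leading v ≟F 0F))

normalized-representative : ∀ v → v ≢ 0V → T (normalized (representative v))
normalized-representative = from-yes (∀Vec3? λ v → ¬? (v ≟V 0V) →-dec T? (normalized (representative v)))

pointOf : (v : Vec3) → v ≢ 0V → Point
pointOf v v≢0 = representative v , normalized-representative v v≢0

-- Implicit arguments below are supplied explicitly wherever unification would otherwise have to
-- look inside F₈ arithmetic: it unfolds into Boolean circuits and does not finish in practice.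
∝-representative : ∀ {v} → v ≢ 0V → Proportional v (representative v)
∝-representative {v} v≢0 = leading v ⁻¹ , ⁻¹-≢0 (leading v) (leading≢0 v v≢0) , refl

∝-refl : ∀ v → Proportional v v
∝-refl v = 1F , (λ ()) , sym (•-identityˡ v)

∝-• : ∀ {k} v → k ≢ 0F → Proportional v (k • v)
∝-• {k} v k≢0 = k , k≢0 , refl

∝-sym : ∀ {v w} → Proportional v w → Proportional w v
∝-sym {v} {w} (l , l≢0 , w≡lv) = l ⁻¹ , ⁻¹-≢0 l l≢0 , (begin
  v                  ≡⟨ sym (•-identityˡ v) ⟩
  1F • v             ≡⟨ cong (_• v) (sym (⁻¹-inverseˡ l l≢0)) ⟩
  (l ⁻¹ *F l) • v    ≡⟨ sym (•-assoc (l ⁻¹) l v) ⟩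
  l ⁻¹ • (l • v)     ≡⟨ cong (l ⁻¹ •_) (sym w≡lv) ⟩
  l ⁻¹ • w           ∎)
  where open ≡-Reasoning

∝-trans : ∀ {u v w} → Proportional u v → Proportional v w → Proportional u w
∝-trans {u} (l , l≢0 , v≡lu) (m , m≢0 , w≡mv) =
  m *F l , *F-≢0 m l m≢0 l≢0 , trans w≡mv (trans (cong (m •_) v≡lu) (•-assoc m l u))

∝-· : ∀ M {v w} → Proportional v w → Proportional (M · v) (M · w)
∝-· M {v} (l , l≢0 , w≡lv) = l , l≢0 , trans (cong (M ·_) w≡lv) (·-• M l v)

evalQ-∝ : ∀ Q {v w} → Proportional v w → evalQ Q v ≡ 0F → evalQ Q w ≡ 0F
evalQ-∝ Q {v} (l , _ , w≡lv) Qv≡0 = begin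
  evalQ Q _              ≡⟨ cong (evalQ Q) w≡lv ⟩
  evalQ Q (l • v)        ≡⟨ evalQ-• Q l v ⟩
  l *F l *F evalQ Q v    ≡⟨ cong (l *F l *F_) Qv≡0 ⟩
  l *F l *F 0F           ≡⟨ *F-zeroʳ (l *F l) ⟩
  0F                     ∎
  where open ≡-Reasoning

det3-∝ : ∀ {u v w u′ v′ w′} → Proportional u u′ → Proportional v v′ → Proportional w w′ →
         det3 u v w ≡ 0F → det3 u′ v′ w′ ≡ 0F
det3-∝ {u} {v} {w} (a , _ , refl) (b , _ , refl) (c , _ , refl) uvw≡0 = begin
  det3 (a • u) (b • v) (c • w)     ≡⟨ det3-• a b c u v w ⟩
  a *F b *F c *F det3 u v w        ≡⟨ cong (a *F b *F c *F_) uvw≡0 ⟩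
  a *F b *F c *F 0F                ≡⟨ *F-zeroʳ (a *F b *F c) ⟩
  0F                               ∎
  where open ≡-Reasoning

det3-image : ∀ M {u v w p q r} → Proportional p (M · u) → Proportional q (M · v) → Proportional r (M · w) →
             det3 u v w ≡ 0F → det3 p q r ≡ 0F
det3-image M {u} {v} {w} p∝Mu q∝Mv r∝Mw uvw≡0 =
  det3-∝ (∝-sym p∝Mu) (∝-sym q∝Mv) (∝-sym r∝Mw)
         (trans (det3-· M u v w) (trans (cong (detM M *F_) uvw≡0) (*F-zeroʳ (detM M))))

record Pullback (Q : QForm) (A : Mat3) (Q′ : QForm) : Set where
  field
    factor : F8
    factor≢0 : factor ≢ 0F
    evalQ-· : ∀ x → evalQ Q (A · x) ≡ factor *F evalQ Q′ x

  zeros : ∀ x → evalQ Q (A · x) ≡ 0F ⇔ evalQ Q′ x ≡ 0F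
  zeros x = mk⇔ (λ QAx≡0 → *F-cancelˡ-≡0 factor (evalQ Q′ x) factor≢0 (trans (sym (evalQ-· x)) QAx≡0))
                (λ Q′x≡0 → trans (evalQ-· x) (trans (cong (factor *F_) Q′x≡0) (*F-zeroʳ factor)))

  polar-· : ∀ x y → polar Q (A · x) (A · y) ≡ factor *F polar Q′ x y
  polar-· x y = begin
    evalQ Q ((A · x) +V (A · y)) +F evalQ Q (A · x) +F evalQ Q (A · y)
      ≡⟨ cong (λ z → evalQ Q z +F evalQ Q (A · x) +F evalQ Q (A · y)) (sym (·-+V A x y)) ⟩
    evalQ Q (A · (x +V y)) +F evalQ Q (A · x) +F evalQ Q (A · y)
      ≡⟨ cong₂ _+F_ (cong₂ _+F_ (evalQ-· (x +V y)) (evalQ-· x)) (evalQ-· y) ⟩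
    factor *F evalQ Q′ (x +V y) +F factor *F evalQ Q′ x +F factor *F evalQ Q′ y
      ≡⟨ cong (_+F factor *F evalQ Q′ y) (sym (*F-distribˡ factor _ _)) ⟩
    factor *F (evalQ Q′ (x +V y) +F evalQ Q′ x) +F factor *F evalQ Q′ y
      ≡⟨ sym (*F-distribˡ factor _ _) ⟩
    factor *F polar Q′ x y ∎
    where open ≡-Reasoning

compose-pullback : ∀ {Q A Q′ κ} → κ ≢ 0F → compose Q A ≡ scaleQ κ Q′ → Pullback Q A Q′
compose-pullback {Q} {A} {Q′} {κ} κ≢0 Q∘A≡κQ′ = record
  { factor = κ
  ; factor≢0 = κ≢0
  ; evalQ-· = λ x → trans (sym (evalQ-compose Q A x)) (trans (cong (λ R → evalQ R x) Q∘A≡κQ′) (evalQ-scaleQ κ Q′ x))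
  }

pullback-⊙ : ∀ {Q A Q′ B Q″} → Pullback Q A Q′ → Pullback Q′ B Q″ → Pullback Q (A ⊙ B) Q″
pullback-⊙ {Q} {A} {Q′} {B} {Q″} pb pb′ = record
  { factor = k *F k′
  ; factor≢0 = *F-≢0 k k′ (Pullback.factor≢0 pb) (Pullback.factor≢0 pb′)
  ; evalQ-· = λ x → begin
      evalQ Q ((A ⊙ B) · x)       ≡⟨ cong (evalQ Q) (⊙-· A B x) ⟩
      evalQ Q (A · (B · x))       ≡⟨ Pullback.evalQ-· pb (B · x) ⟩
      k *F evalQ Q′ (B · x)       ≡⟨ cong (k *F_) (Pullback.evalQ-· pb′ x) ⟩
      k *F (k′ *F evalQ Q″ x)     ≡⟨ sym (*F-assoc k k′ _) ⟩
      k *F k′ *F evalQ Q″ x       ∎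
  }
  where
  open ≡-Reasoning
  k k′ : F8
  k = Pullback.factor pb
  k′ = Pullback.factor pb′

pullback-adj : ∀ {Q A Q′} → detM A ≢ 0F → Pullback Q A Q′ → Pullback Q′ (adj A) Q
pullback-adj {Q} {A} {Q′} detA≢0 pb = record
  { factor = k ⁻¹ *F (d *F d)
  ; factor≢0 = *F-≢0 (k ⁻¹) (d *F d) (⁻¹-≢0 k k≢0) (*F-≢0 d d detA≢0 detA≢0)
  ; evalQ-· = λ y → begin
      evalQ Q′ (adj A · y)                  ≡⟨ sym (⁻¹-cancelˡ k _ k≢0) ⟩
      k ⁻¹ *F (k *F evalQ Q′ (adj A · y))   ≡⟨ cong (k ⁻¹ *F_) (sym (Pullback.evalQ-· pb (adj A · y))) ⟩
      k ⁻¹ *F evalQ Q (A · (adj A · y))     ≡⟨ cong (λ z → k ⁻¹ *F evalQ Q z) (·-adj-cancel A y) ⟩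
      k ⁻¹ *F evalQ Q (d • y)               ≡⟨ cong (k ⁻¹ *F_) (evalQ-• Q d y) ⟩
      k ⁻¹ *F (d *F d *F evalQ Q y)         ≡⟨ sym (*F-assoc (k ⁻¹) (d *F d) _) ⟩
      k ⁻¹ *F (d *F d) *F evalQ Q y         ∎
  }
  where
  open ≡-Reasoning
  k d : F8
  k = Pullback.factor pb
  d = detM A
  k≢0 : k ≢ 0F
  k≢0 = Pullback.factor≢0 pb

monic : QForm → QForm
monic (qform a b c d e f) = qform 1F (a ⁻¹ *F b) (a ⁻¹ *F c) (a ⁻¹ *F d) (a ⁻¹ *F e) (a ⁻¹ *F f)

scaleQ-monic : ∀ Q → QForm.a Q ≢ 0F → Q ≡ scaleQ (QForm.a Q) (monic Q)
scaleQ-monic (qform a b c d e f) a≢0 =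
  sym (cong₆ (*F-identityʳ a) (⁻¹-cancelʳ a b a≢0) (⁻¹-cancelʳ a c a≢0)
             (⁻¹-cancelʳ a d a≢0) (⁻¹-cancelʳ a e a≢0) (⁻¹-cancelʳ a f a≢0))
  where
  cong₆ : ∀ {a b c d e f a′ b′ c′ d′ e′ f′} → a ≡ a′ → b ≡ b′ → c ≡ c′ → d ≡ d′ → e ≡ e′ → f ≡ f′ →
          qform a b c d e f ≡ qform a′ b′ c′ d′ e′ f′
  cong₆ refl refl refl refl refl refl = refl

pullback-monic : ∀ Q A → QForm.a (compose Q A) ≢ 0F → Pullback Q A (monic (compose Q A))
pullback-monic Q A a≢0 = compose-pullback a≢0 (scaleQ-monic (compose Q A) a≢0)

compose-a : ∀ Q M → QForm.a (compose Q M) ≡ evalQ Q (M · e₁)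
compose-a Q ((a₁ , a₂ , a₃) , (b₁ , b₂ , b₃) , (c₁ , c₂ , c₃)) =
  cong (evalQ Q) (sym (coords≡ (dot-e₁ (a₁ , a₂ , a₃)) (dot-e₁ (b₁ , b₂ , b₃)) (dot-e₁ (c₁ , c₂ , c₃))))

-- ExternalPentagon and its parts, for five vectors rather than five points;
-- ExternalPentagon Q P is ExternalPentagonᵛ Q (λ i → coords (P i)).

ExternalLine : QForm → Vec3 → Vec3 → Set
ExternalLine Q v w = ∀ (x : Point) → OnConic Q x → ¬ det3 v w (coords x) ≡ 0F

GeneralPositionᵛ : (Fin 5 → Vec3) → Set
GeneralPositionᵛ V = ∀ (i j k : Fin 5) → ¬ i ≡ j → ¬ i ≡ k → ¬ j ≡ k → ¬ det3 (V i) (V j) (V k) ≡ 0F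

ExternalPentagonᵛ : QForm → (Fin 5 → Vec3) → Set
ExternalPentagonᵛ Q V = GeneralPositionᵛ V × (∀ (i j : Fin 5) → ¬ i ≡ j → ExternalLine Q (V i) (V j))

module Transport {Q A Q′} (detA≢0 : detM A ≢ 0F) (pb : Pullback Q A Q′) where

  image : Point → Point
  image x = pointOf (A · coords x) (·-≢0V A detA≢0 (coords≢0V x))

  ∝-image : ∀ x → Proportional (A · coords x) (coords (image x))
  ∝-image x = ∝-representative (·-≢0V A detA≢0 (coords≢0V x))

  image-onConic : ∀ x → OnConic Q′ x → OnConic Q (image x)
  image-onConic x x∈Q′ = evalQ-∝ Q (∝-image x) (Equivalence.from (Pullback.zeros pb (coords x)) x∈Q′)

  externalLine : ∀ {p q v w} → Proportional p (A · v) → Proportional q (A · w) →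
                 ExternalLine Q p q → ExternalLine Q′ v w
  externalLine p∝Av q∝Aw pq-external x x∈Q′ vwx≡0 =
    pq-external (image x) (image-onConic x x∈Q′) (det3-image A p∝Av q∝Aw (∝-sym (∝-image x)) vwx≡0)

  externalPentagon : ∀ {W V} → (∀ i → Proportional (W i) (A · V i)) →
                     ExternalPentagonᵛ Q W → ExternalPentagonᵛ Q′ V
  externalPentagon W∝AV (general , external) =
    (λ i j k i≢j i≢k j≢k Vijk≡0 → general i j k i≢j i≢k j≢k (det3-image A (W∝AV i) (W∝AV j) (W∝AV k) Vijk≡0)) ,
    (λ i j i≢j → externalLine (W∝AV i) (W∝AV j) (external i j i≢j))

  nonSingular : NonSingular Q → NonSingular Q′
  nonSingular nsQ x (x∈Q′ , x-radical) = nsQ (image x) (image-onConic x x∈Q′ , image-radical)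
    where
    open ≡-Reasoning
    d k l : F8
    d = detM A
    k = Pullback.factor pb
    l = leading (A · coords x) ⁻¹
    Ax-radical : ∀ w → polar Q (A · coords x) w ≡ 0F
    Ax-radical w = *F-cancelˡ-≡0 d (polar Q (A · coords x) w) detA≢0 (begin
      d *F polar Q (A · coords x) w                 ≡⟨ sym (polar-•ʳ Q d (A · coords x) w) ⟩
      polar Q (A · coords x) (d • w)                ≡⟨ cong (polar Q (A · coords x)) (sym (·-adj-cancel A w)) ⟩
      polar Q (A · coords x) (A · (adj A · w))      ≡⟨ Pullback.polar-· pb (coords x) (adj A · w) ⟩
      k *F polar Q′ (coords x) (adj A · w)          ≡⟨ cong (k *F_) (x-radical (adj A · w)) ⟩
      k *F 0F                                       ≡⟨ *F-zeroʳ k ⟩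
      0F                                            ∎)
    image-radical : ∀ w → polar Q (coords (image x)) w ≡ 0F
    image-radical w = begin
      polar Q (l • (A · coords x)) w      ≡⟨ polar-•ˡ Q l (A · coords x) w ⟩
      l *F polar Q (A · coords x) w       ≡⟨ cong (l *F_) (Ax-radical w) ⟩
      l *F 0F                             ≡⟨ *F-zeroʳ l ⟩
      0F                                  ∎

pattern i₀ = zero
pattern i₁ = suc i₀
pattern i₂ = suc i₁
pattern i₃ = suc i₂
pattern i₄ = suc i₃

corner : Fin 4 → Vec3
corner i₀ = e₁
corner i₁ = e₂
corner i₂ = e₃
corner i₃ = e₄

frame : Vec3 → Fin 5 → Vec3
frame u i₀ = e₁
frame u i₁ = e₂
frame u i₂ = e₃
frame u i₃ = e₄
frame u i₄ = u

-- Rewriting along these (rather than relying on frame u i₀ reducing to e₁ inside a product or a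
-- determinant) keeps the conversion checker from unfolding F₈ arithmetic.
frame-first : ∀ u → frame u i₀ ≡ e₁
frame-first u = refl

frame-last : ∀ u → frame u i₄ ≡ u
frame-last u = refl

frame-corner : ∀ u i → frame u (inject₁ i) ≡ corner i
frame-corner u i₀ = refl
frame-corner u i₁ = refl
frame-corner u i₂ = refl
frame-corner u i₃ = refl

inject₁-≢ : ∀ {i j : Fin 4} → i < j → inject₁ i ≢ inject₁ j
inject₁-≢ i<j = <⇒≢ i<j ∘ inject₁-injective

-- The columns are μₖ pₖ for the Cramer coefficients μₖ, so that e₄ is sent to a multiple of p₃.
frameMatrix : Vec3 → Vec3 → Vec3 → Vec3 → Mat3
frameMatrix p₀ p₁ p₂ p₃ = tr (det3 p₃ p₁ p₂ • p₀ , det3 p₀ p₃ p₂ • p₁ , det3 p₀ p₁ p₃ • p₂)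

tr-·-e₁ : ∀ a b c → tr (a , b , c) · e₁ ≡ a
tr-·-e₁ (a₁ , a₂ , a₃) (b₁ , b₂ , b₃) (c₁ , c₂ , c₃) =
  coords≡ (dot-e₁ (a₁ , b₁ , c₁)) (dot-e₁ (a₂ , b₂ , c₂)) (dot-e₁ (a₃ , b₃ , c₃))

tr-·-e₂ : ∀ a b c → tr (a , b , c) · e₂ ≡ b
tr-·-e₂ (a₁ , a₂ , a₃) (b₁ , b₂ , b₃) (c₁ , c₂ , c₃) =
  coords≡ (dot-e₂ (a₁ , b₁ , c₁)) (dot-e₂ (a₂ , b₂ , c₂)) (dot-e₂ (a₃ , b₃ , c₃))

tr-·-e₃ : ∀ a b c → tr (a , b , c) · e₃ ≡ c
tr-·-e₃ (a₁ , a₂ , a₃) (b₁ , b₂ , b₃) (c₁ , c₂ , c₃) =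
  coords≡ (dot-e₃ (a₁ , b₁ , c₁)) (dot-e₃ (a₂ , b₂ , c₂)) (dot-e₃ (a₃ , b₃ , c₃))

tr-·-e₄ : ∀ a b c → tr (a , b , c) · e₄ ≡ (a +V b) +V c
tr-·-e₄ (a₁ , a₂ , a₃) (b₁ , b₂ , b₃) (c₁ , c₂ , c₃) =
  coords≡ (dot-e₄ (a₁ , b₁ , c₁)) (dot-e₄ (a₂ , b₂ , c₂)) (dot-e₄ (a₃ , b₃ , c₃))

frameMatrix-e₄ : ∀ p₀ p₁ p₂ p₃ → frameMatrix p₀ p₁ p₂ p₃ · e₄ ≡ det3 p₀ p₁ p₂ • p₃
frameMatrix-e₄ p₀ p₁ p₂ p₃ =
  trans (tr-·-e₄ (det3 p₃ p₁ p₂ • p₀) (det3 p₀ p₃ p₂ • p₁) (det3 p₀ p₁ p₃ • p₂)) (cramer p₀ p₁ p₂ p₃)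

detM-frameMatrix : ∀ p₀ p₁ p₂ p₃ →
  detM (frameMatrix p₀ p₁ p₂ p₃) ≡ det3 p₃ p₁ p₂ *F det3 p₀ p₃ p₂ *F det3 p₀ p₁ p₃ *F det3 p₀ p₁ p₂
detM-frameMatrix p₀ p₁ p₂ p₃ =
  trans (detM-tr (det3 p₃ p₁ p₂ • p₀ , det3 p₀ p₃ p₂ • p₁ , det3 p₀ p₁ p₃ • p₂))
        (det3-• (det3 p₃ p₁ p₂) (det3 p₀ p₃ p₂) (det3 p₀ p₁ p₃) p₀ p₁ p₂)

record FrameChange (p : Fin 5 → Vec3) : Set where
  field
    A : Mat3
    detA≢0 : detM A ≢ 0F
    u : Point
    maps : ∀ i → Proportional (p i) (A · frame (coords u) i)

module _ (p : Fin 5 → Vec3) (general : GeneralPositionᵛ p) where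

  private
    μ₀ μ₁ μ₂ D : F8
    μ₀ = det3 (p i₃) (p i₁) (p i₂)
    μ₁ = det3 (p i₀) (p i₃) (p i₂)
    μ₂ = det3 (p i₀) (p i₁) (p i₃)
    D = det3 (p i₀) (p i₁) (p i₂)

    μ₀≢0 : μ₀ ≢ 0F
    μ₀≢0 = general i₃ i₁ i₂ (λ ()) (λ ()) (λ ())
    μ₁≢0 : μ₁ ≢ 0F
    μ₁≢0 = general i₀ i₃ i₂ (λ ()) (λ ()) (λ ())
    μ₂≢0 : μ₂ ≢ 0F
    μ₂≢0 = general i₀ i₁ i₃ (λ ()) (λ ()) (λ ())
    D≢0 : D ≢ 0F
    D≢0 = general i₀ i₁ i₂ (λ ()) (λ ()) (λ ())

    A : Mat3
    A = frameMatrix (p i₀) (p i₁) (p i₂) (p i₃)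

    detA≢0 : detM A ≢ 0F
    detA≢0 = subst (_≢ 0F) (sym (detM-frameMatrix (p i₀) (p i₁) (p i₂) (p i₃)))
                   (*F-≢0 (μ₀ *F μ₁ *F μ₂) D (*F-≢0 (μ₀ *F μ₁) μ₂ (*F-≢0 μ₀ μ₁ μ₀≢0 μ₁≢0) μ₂≢0) D≢0)

    p₄≢0 : p i₄ ≢ 0V
    p₄≢0 p₄≡0 = general i₄ i₀ i₁ (λ ()) (λ ()) (λ ())
                        (subst (λ v → det3 v (p i₀) (p i₁) ≡ 0F) (sym p₄≡0) (det3-0V (p i₀) (p i₁)))

    adjA·p₄≢0 : adj A · p i₄ ≢ 0V
    adjA·p₄≢0 = ·-≢0V (adj A) (detM-adj≢0 A detA≢0) p₄≢0

    u : Point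
    u = pointOf (adj A · p i₄) adjA·p₄≢0

    maps : ∀ i → Proportional (p i) (A · frame (coords u) i)
    maps i₀ = μ₀ , μ₀≢0 , tr-·-e₁ (μ₀ • p i₀) (μ₁ • p i₁) (μ₂ • p i₂)
    maps i₁ = μ₁ , μ₁≢0 , tr-·-e₂ (μ₀ • p i₀) (μ₁ • p i₁) (μ₂ • p i₂)
    maps i₂ = μ₂ , μ₂≢0 , tr-·-e₃ (μ₀ • p i₀) (μ₁ • p i₁) (μ₂ • p i₂)
    maps i₃ = D , D≢0 , frameMatrix-e₄ (p i₀) (p i₁) (p i₂) (p i₃)
    maps i₄ = subst (λ x → Proportional (p i₄) (A · x)) (sym (frame-last (coords u)))
                    (∝-trans p₄∝A·adjA·p₄ (∝-· A adjA·p₄∝u))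
      where
      p₄∝A·adjA·p₄ : Proportional (p i₄) (A · (adj A · p i₄))
      p₄∝A·adjA·p₄ = subst (Proportional (p i₄)) (sym (·-adj-cancel A (p i₄))) (∝-• (p i₄) detA≢0)
      adjA·p₄∝u : Proportional (adj A · p i₄) (coords u)
      adjA·p₄∝u = ∝-representative adjA·p₄≢0

  frameChange : FrameChange p
  frameChange = record { A = A ; detA≢0 = detA≢0 ; u = u ; maps = maps }

-- The values of Q on the line through v and w are s²Q(v) + sB(v, w) + Q(w) (evalQ-line);
-- the three coefficients are computed once per line.
Secant : QForm → Vec3 → Vec3 → Set
Secant Q v w = ∃ λ s → s *F s *F evalQ Q v +F s *F polar Q v w +F evalQ Q w ≡ 0F × s • v +V w ≢ 0V

secant? : ∀ Q v w → Dec (Secant Q v w)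
secant? Q v w = on-line (evalQ Q v) (polar Q v w) (evalQ Q w)
  where
  on-line : ∀ α β γ → Dec (∃ λ s → s *F s *F α +F s *F β +F γ ≡ 0F × s • v +V w ≢ 0V)
  on-line α β γ = ∃F8? λ s → (s *F s *F α +F s *F β +F γ ≟F 0F) ×-dec ¬? (s • v +V w ≟V 0V)

SingularNucleus : QForm → Set
SingularNucleus Q = nucleus Q ≢ 0V × evalQ Q (nucleus Q) ≡ 0F

RepresentsStd : Vec3 → Fin 5 → Set
RepresentsStd v j = representative v ≡ stdPentagon j

CertifiedBy : QForm → Vec3 → Mat3 → Set
CertifiedBy Q u N =
  (∀ i → ∃ λ j → RepresentsStd (N · frame u i) j) × (∀ j → ∃ λ i → RepresentsStd (N · frame u i) j) ×
  detM N ≢ 0F × QForm.a (compose stdConic N) ≢ 0F × compose stdConic N ≡ scaleQ (QForm.a (compose stdConic N)) Q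

certifiedBy? : ∀ Q u N → Dec (CertifiedBy Q u N)
certifiedBy? Q u N =
  ∀Fin? (λ i → ∃Fin? λ j → representative (N · frame u i) ≟V stdPentagon j) ×-dec
  ∀Fin? (λ j → ∃Fin? λ i → representative (N · frame u i) ≟V stdPentagon j) ×-dec
  ¬? (detM N ≟F 0F) ×-dec ¬? (QForm.a (compose stdConic N) ≟F 0F) ×-dec
  compose stdConic N ≟Q scaleQ (QForm.a (compose stdConic N)) Q

-- The candidates for N send the standard frame to four points of the standard pentagon.
stdFrameMatrix : Fin 5 → Fin 5 → Fin 5 → Fin 5 → Mat3
stdFrameMatrix j₀ j₁ j₂ j₃ = frameMatrix (stdPentagon j₀) (stdPentagon j₁) (stdPentagon j₂) (stdPentagon j₃)

Certified : QForm → Vec3 → Set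
Certified Q u = ∃ λ j₀ → ∃ λ j₁ → ∃ λ j₂ → ∃ λ j₃ → CertifiedBy Q u (stdFrameMatrix j₀ j₁ j₂ j₃)

certified? : ∀ Q u → Dec (Certified Q u)
certified? Q u = ∃Fin? λ j₀ → ∃Fin? λ j₁ → ∃Fin? λ j₂ → ∃Fin? λ j₃ → certifiedBy? Q u (stdFrameMatrix j₀ j₁ j₂ j₃)

ConicExcluded : QForm → Set
ConicExcluded Q = (∃₂ λ i j → i < j × Secant Q (corner i) (corner j)) ⊎ SingularNucleus Q

conicExcluded? : ∀ Q → Dec (ConicExcluded Q)
conicExcluded? Q = (∃Fin? λ i → ∃Fin? λ j → (i <? j) ×-dec secant? Q (corner i) (corner j)) ⊎-dec
                   (¬? (nucleus Q ≟V 0V) ×-dec (evalQ Q (nucleus Q) ≟F 0F))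

PointExcluded : QForm → Vec3 → Set
PointExcluded Q u = (∃₂ λ i j → i < j × det3 (corner i) (corner j) u ≡ 0F) ⊎ (∃ λ i → Secant Q (corner i) u)

pointExcluded? : ∀ Q u → Dec (PointExcluded Q u)
pointExcluded? Q u = (∃Fin? λ i → ∃Fin? λ j → (i <? j) ×-dec (det3 (corner i) (corner j) u ≟F 0F)) ⊎-dec
                     (∃Fin? λ i → secant? Q (corner i) u)

Classification : Set
Classification = ∀ b c d e f → let Q = qform 1F b c d e f in
  ConicExcluded Q ⊎ ∀ u → T (normalized u) → PointExcluded Q u ⊎ Certified Q u

classification : Classification
classification = from-yes (
  ∀F8? λ b → ∀F8? λ c → ∀F8? λ d → ∀F8? λ e → ∀F8? λ f → let Q = qform 1F b c d e f in
  conicExcluded? Q ⊎-dec ∀Vec3? λ u → T? (normalized u) →-dec (pointExcluded? Q u ⊎-dec certified? Q u))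

secant⇒¬external : ∀ {Q v w} → Secant Q v w → ¬ ExternalLine Q v w
secant⇒¬external {Q} {v} {w} (s , on-conic , x≢0) external = external (pointOf x x≢0) x∈Q collinear
  where
  x : Vec3
  x = s • v +V w
  x∈Q : evalQ Q (representative x) ≡ 0F
  x∈Q = evalQ-∝ Q (∝-representative x≢0) (trans (evalQ-line Q s v w) on-conic)
  collinear : det3 v w (representative x) ≡ 0F
  collinear = det3-∝ (∝-refl v) (∝-refl w) (∝-representative x≢0) (det3-line s v w)

singularNucleus⇒singular : ∀ {Q} → SingularNucleus Q → ¬ NonSingular Q
singularNucleus⇒singular {Q} (n≢0 , on-conic) nonSingular =
  nonSingular (pointOf (nucleus Q) n≢0) (evalQ-∝ Q (∝-representative n≢0) on-conic , radical)
  where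
  l : F8
  l = leading (nucleus Q) ⁻¹
  radical : ∀ w → polar Q (l • nucleus Q) w ≡ 0F
  radical w = trans (polar-•ˡ Q l (nucleus Q) w) (trans (cong (l *F_) (polar-nucleus Q w)) (*F-zeroʳ l))

conicExcluded⇒¬external : ∀ {Q} u → ConicExcluded Q → NonSingular Q → ¬ ExternalPentagonᵛ Q (frame u)
conicExcluded⇒¬external {Q} u (inj₁ (i , j , i<j , secant)) _ (_ , external) =
  secant⇒¬external {Q} {corner i} {corner j} secant corner-external
  where
  corner-external : ExternalLine Q (corner i) (corner j)
  corner-external = subst₂ (ExternalLine Q) (frame-corner u i) (frame-corner u j)
                           (external (inject₁ i) (inject₁ j) (inject₁-≢ i<j))
conicExcluded⇒¬external {Q} u (inj₂ singular) nonSingular _ = singularNucleus⇒singular {Q} singular nonSingular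

pointExcluded⇒¬external : ∀ {Q} u → PointExcluded Q u → ¬ ExternalPentagonᵛ Q (frame u)
pointExcluded⇒¬external {Q} u (inj₁ (i , j , i<j , collinear)) (general , _) =
  general (inject₁ i) (inject₁ j) (fromℕ 4) (inject₁-≢ i<j) (fromℕ≢inject₁ ∘ sym) (fromℕ≢inject₁ ∘ sym)
          frame-collinear
  where
  frame-collinear : det3 (frame u (inject₁ i)) (frame u (inject₁ j)) u ≡ 0F
  frame-collinear = subst₂ (λ v w → det3 v w u ≡ 0F) (sym (frame-corner u i)) (sym (frame-corner u j)) collinear
pointExcluded⇒¬external {Q} u (inj₂ (i , secant)) (_ , external) =
  secant⇒¬external {Q} {corner i} {u} secant corner-external
  where
  corner-external : ExternalLine Q (corner i) u
  corner-external = subst (λ v → ExternalLine Q v u) (frame-corner u i)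
                          (external (inject₁ i) (fromℕ 4) (fromℕ≢inject₁ ∘ sym))

pointExcluded-or-certified : ∀ {Q} u → ExternalPentagonᵛ Q (frame u) → PointExcluded Q u ⊎ Certified Q u →
                             Certified Q u
pointExcluded-or-certified {Q} u external (inj₁ excluded) = contradiction external (pointExcluded⇒¬external {Q} u excluded)
pointExcluded-or-certified u _ (inj₂ certified) = certified

excluded-or-certified : ∀ {Q} (u : Point) → NonSingular Q → ExternalPentagonᵛ Q (frame (coords u)) →
  ConicExcluded Q ⊎ (∀ v → T (normalized v) → PointExcluded Q v ⊎ Certified Q v) → Certified Q (coords u)
excluded-or-certified {Q} u nonSingular external (inj₁ excluded) =
  contradiction external (conicExcluded⇒¬external {Q} (coords u) excluded nonSingular)
excluded-or-certified {Q} u _ external (inj₂ classified) =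
  pointExcluded-or-certified {Q} (coords u) external (classified (coords u) (proj₂ u))

classify : ∀ {b c d e f} (u : Point) → NonSingular (qform 1F b c d e f) →
           ExternalPentagonᵛ (qform 1F b c d e f) (frame (coords u)) → Certified (qform 1F b c d e f) (coords u)
classify {b} {c} {d} {e} {f} u nonSingular external =
  excluded-or-certified {qform 1F b c d e f} u nonSingular external (classification b c d e f)

monic-shape : ∀ Q → qform 1F (QForm.b (monic Q)) (QForm.c (monic Q)) (QForm.d (monic Q)) (QForm.e (monic Q))
                             (QForm.f (monic Q)) ≡ monic Q
monic-shape Q = refl

classify-monic : ∀ Q (u : Point) → NonSingular (monic Q) → ExternalPentagonᵛ (monic Q) (frame (coords u)) →
                 Certified (monic Q) (coords u)
classify-monic Q u = subst (λ R → NonSingular R → ExternalPentagonᵛ R (frame (coords u)) → Certified R (coords u))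
                           (monic-shape Q) (classify u)

stdPentagon≢0V : ∀ j → stdPentagon j ≢ 0V
stdPentagon≢0V = from-yes (∀Fin? λ j → ¬? (stdPentagon j ≟V 0V))

representsStd⇒≢0V : ∀ {v j} → RepresentsStd v j → v ≢ 0V
representsStd⇒≢0V {v} {j} rep≡std refl = stdPentagon≢0V j (sym rep≡std)

representsStd⇒∝ : ∀ {v j} → RepresentsStd v j → Proportional v (stdPentagon j)
representsStd⇒∝ {v} {j} rep≡std =
  subst (Proportional v) rep≡std (∝-representative {v} (representsStd⇒≢0V {v} {j} rep≡std))

StandardForm : QForm → Pentagon → Mat3 → Set
StandardForm Q P M = ¬ detM M ≡ 0F ×
  (∀ (p : Point) → OnConic Q p ⇔ evalQ stdConic (M · coords p) ≡ 0F) ×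
  (∀ (i : Fin 5) → ∃ λ (j : Fin 5) → Proportional (M · coords (P i)) (stdPentagon j)) ×
  (∀ (j : Fin 5) → ∃ λ (i : Fin 5) → Proportional (M · coords (P i)) (stdPentagon j))

module FromCertificate {Q A Q₂ u} {P : Pentagon} (detA≢0 : detM A ≢ 0F) (pullback : Pullback Q A Q₂)
                       (maps : ∀ i → Proportional (coords (P i)) (A · frame u i)) where

  private
    image-∝ : ∀ N i → Proportional ((N ⊙ adj A) · coords (P i)) (N · frame u i)
    image-∝ N i = subst (λ x → Proportional x (N · frame u i)) (sym (⊙-· N (adj A) (coords (P i))))
                        (∝-· N {adj A · coords (P i)} {frame u i} adjA·P∝frame)
      where
      adjA·P∝frame : Proportional (adj A · coords (P i)) (frame u i)
      adjA·P∝frame = ∝-trans {adj A · coords (P i)} {detM A • frame u i} {frame u i}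
        (subst (Proportional (adj A · coords (P i))) (adj-·-cancel A (frame u i))
               (∝-· (adj A) {coords (P i)} {A · frame u i} (maps i)))
        (∝-sym {frame u i} {detM A • frame u i} (∝-• (frame u i) detA≢0))

  standardForm : ∀ {N} → CertifiedBy Q₂ u N → StandardForm Q P (N ⊙ adj A)
  standardForm {N} (images , preimages , detN≢0 , κ≢0 , std∘N≡κQ₂) =
    detM≢0 ,
    (λ p → let zeros = Pullback.zeros pullbackM (coords p) in mk⇔ (Equivalence.from zeros) (Equivalence.to zeros)) ,
    (λ i → let j , represents = images i in j , image i represents) ,
    (λ j → let i , represents = preimages j in i , image i represents)
    where
    pullbackM : Pullback stdConic (N ⊙ adj A) Q
    pullbackM = pullback-⊙ (compose-pullback {stdConic} {N} {Q₂} {QForm.a (compose stdConic N)} κ≢0 std∘N≡κQ₂)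
                           (pullback-adj detA≢0 pullback)
    detM≢0 : detM (N ⊙ adj A) ≢ 0F
    detM≢0 = subst (_≢ 0F) (sym (detM-⊙ N (adj A))) (*F-≢0 (detM (adj A)) (detM N) (detM-adj≢0 A detA≢0) detN≢0)
    image : ∀ i {j} → RepresentsStd (N · frame u i) j → Proportional ((N ⊙ adj A) · coords (P i)) (stdPentagon j)
    image i {j} represents = ∝-trans (image-∝ N i) (representsStd⇒∝ {N · frame u i} {j} represents)

  fromCertified : Certified Q₂ u → ∃ (StandardForm Q P)
  fromCertified (j₀ , j₁ , j₂ , j₃ , certifiedBy) =
    stdFrameMatrix j₀ j₁ j₂ j₃ ⊙ adj A , standardForm {stdFrameMatrix j₀ j₁ j₂ j₃} certifiedBy

module Normalisation {Q : QForm} {P : Pentagon} (nonSingular : NonSingular Q) (external : ExternalPentagon Q P)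
                     (frameChange : FrameChange (λ i → coords (P i))) where
  open FrameChange frameChange

  private
    P₀∝Ae₁ : Proportional (A · e₁) (coords (P i₀))
    P₀∝Ae₁ = ∝-sym {coords (P i₀)} {A · e₁}
                   (subst (λ x → Proportional (coords (P i₀)) (A · x)) (frame-first (coords u)) (maps i₀))

    Ae₁∉Q : evalQ Q (A · e₁) ≢ 0F
    Ae₁∉Q QAe₁≡0 = proj₂ external i₀ i₁ (λ ()) (P i₀) (evalQ-∝ Q {A · e₁} {coords (P i₀)} P₀∝Ae₁ QAe₁≡0)
                         (det3-repeat (coords (P i₀)) (coords (P i₁)))

    pullback : Pullback Q A (monic (compose Q A))
    pullback = pullback-monic Q A (λ a≡0 → Ae₁∉Q (trans (sym (compose-a Q A)) a≡0))

    certified : Certified (monic (compose Q A)) (coords u)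
    certified = classify-monic (compose Q A) u
      (Transport.nonSingular detA≢0 pullback nonSingular)
      (Transport.externalPentagon detA≢0 pullback {λ i → coords (P i)} {frame (coords u)} maps external)

  standardForm : ∃ (StandardForm Q P)
  standardForm =
    FromCertificate.fromCertified {Q} {A} {monic (compose Q A)} {coords u} {P} detA≢0 pullback maps certified

lemma3p5 : (Q : QForm) → NonSingular Q → (P : Pentagon) →
    ExternalPentagon Q P → TypeA4 Q P →
    ∃ λ (M : Mat3) → ¬ detM M ≡ 0F ×
      (∀ (p : Point) → OnConic Q p ⇔ evalQ stdConic (M · coords p) ≡ 0F) ×
      (∀ (i : Fin 5) → ∃ λ (j : Fin 5) → Proportional (M · coords (P i)) (stdPentagon j)) ×
      (∀ (j : Fin 5) → ∃ λ (i : Fin 5) → Proportional (M · coords (P i)) (stdPentagon j))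
lemma3p5 Q nonSingular P external _ =
  Normalisation.standardForm {Q} {P} nonSingular external (frameChange (λ i → coords (P i)) (proj₁ external))
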